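{- Consider a depth-first exploration of a finite directed graph augmented with the low computation described in the context. At every moment, for every vertex $v$, with $u$ the leader of the strong component $C$ containing $v$: - after $v$ has been previsited but before $u$ is postvisited, $v.\mathit{low}$ equals the minimum of $w.\mathit{pre}$ over all vertices $w$ reachable from $v$ by a retreating path with all vertices in $C$ on all of whose arcs a retreat has already occurred; - after $u$ has been postvisited, $v.\mathit{low}=\infty$.
   Context: Loops and parallel arcs are allowed. Two vertices are mutually reachable if each is reachable from the other; the equivalence classes are the strong components. A depth-first exploration proceeds as follows. Initially all vertices are unvisited, all arcs untraversed, and the current vertex is null. Repeat the applicable case until all vertices are visited and all arcs are traversed: (i) The current vertex is null and some vertex is unvisited: choose any unvisited $v$, make it current and visit it; $v$ is a root. (ii) The current vertex $v$ has an untraversed exiting arc: choose any such arc $a$, from $v$ to $w$, and advance on it. If $w$ is visited, immediately retreat on $a$. Otherwise $a$ becomes a tree arc, $w$ becomes current and is visited. (iii) The current vertex $v$ has no untraversed exiting arc: if $v$ is a root, the current vertex becomes null; otherwise retreat on the tree arc entering $v$, from $u$ say, and make $u$ current. The first visit of $v$ is its previsit. The step (iii) at which $v$ is current with no untraversed exiting arc is its postvisit. A directed path is retreating if the exploration retreats on its arcs in the reverse of their order along the path; a path with no arcs is retreating. For a path on all of whose arcs retreats have already occurred, this means those retreats occurred in reverse path order. The low computation: - Previsit of $v$: set $v.\mathit{pre}$ to the next integer $1,2,\dots$ and $v.\mathit{low}\gets v.\mathit{pre}$. - Retreat on any arc from $v$ to $w$: set $v.\mathit{low}\gets\min\{v.\mathit{low},w.\mathit{low}\}$.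 - Postvisit of $v$: if $v.\mathit{low}=v.\mathit{pre}$, set $w.\mathit{low}\gets\infty$ for every vertex $w$ in the strong component whose leader is $v$. The leader of a strong component is its vertex with minimum $\mathit{pre}$, and $\infty$ exceeds all integers. -}

module Defs where

open import Data.Nat using (ℕ; zero; suc; _≤_; _<_; _⊓_)
open import Data.Fin using (Fin; _≟_)
open import Data.Bool using (Bool; true; false; if_then_else_)
open import Data.Maybe using (Maybe; just; nothing)
open import Data.Product using (Σ; ∃; _×_; _,_)
open import Data.Unit using (⊤)
open import Relation.Nullary using (¬_; does)
open import Relation.Binary.PropositionalEquality using (_≡_)
open import Relation.Binary.Construct.Closure.ReflexiveTransitive using (Star)

data ℕ∞ : Set where
  fin : ℕ → ℕ∞
  ∞   : ℕ∞

_⊓∞_ : ℕ∞ → ℕ∞ → ℕ∞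
fin a ⊓∞ fin b = fin (a ⊓ b)
fin a ⊓∞ ∞     = fin a
∞     ⊓∞ y     = y

IsMinimum : (ℕ → Set) → ℕ → Set
IsMinimum P p = P p × (∀ q → P q → p ≤ q)

-- A finite directed graph: vertices Fin n, arcs Fin m, each arc with a
-- source and a target (loops and parallel arcs allowed).
record Graph : Set where
  field
    n   : ℕ
    m   : ℕ
    src : Fin m → Fin n
    tgt : Fin m → Fin n

upd : ∀ {k} {A : Set} → (Fin k → A) → Fin k → A → Fin k → A
upd f i x j = if does (i ≟ j) then x else f j

module Exploration (G : Graph) where
  open Graph G

  V = Fin n
  A = Fin m

  data Walk : V → V → Set where
    nil  : ∀ {x} → Walk x x
    cons : ∀ {y} (a : A) → Walk (tgt a) y → Walk (src a) y

  Reach : V → V → Set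
  Reach x y = Walk x y

  -- mutual reachability; the strong component of x is {y ∣ Mutual x y}
  Mutual : V → V → Set
  Mutual x y = Reach x y × Reach y x

  record State : Set where
    field
      pre         : V → Maybe ℕ      -- nothing = not yet visited
      next        : ℕ                -- next integer to assign as pre
      low         : V → Maybe ℕ∞     -- nothing = not yet assigned
      traversed   : A → Bool         -- has the arc been advanced on
      retreatTime : A → Maybe ℕ
      clock       : ℕ                -- number of retreats so far
      current     : Maybe V
      parent      : V → Maybe A      -- tree arc entering v (nothing: root)
      postvisited : V → Bool
  open State public

  initial : State
  initial = record
    { pre = λ _ → nothing ; next = 1 ; low = λ _ → nothing
    ; traversed = λ _ → false ; retreatTime = λ _ → nothing ; clock = 0
    ; current = nothing ; parent = λ _ → nothing ; postvisited = λ _ → false }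

  -- u is the leader of the strong component of v: the vertex of that
  -- component with minimum pre (among vertices that have a pre value)
  Leader : State → V → V → Set
  Leader s u v = Mutual v u × Σ ℕ λ p → pre s u ≡ just p ×
                 (∀ w q → Mutual v w → pre s w ≡ just q → p ≤ q)

  -- The steps of the exploration. Step (iii) is split in two moments:
  -- the postvisit, then the retreat (or the current vertex becoming null).
  data Step (s : State) : State → Set where
    root : ∀ v → current s ≡ nothing → pre s v ≡ nothing →
      Step s record s
        { current = just v
        ; pre = upd (pre s) v (just (next s))
        ; low = upd (low s) v (just (fin (next s)))
        ; next = suc (next s) }
    tree : ∀ v a → current s ≡ just v → src a ≡ v → traversed s a ≡ false →
      pre s (tgt a) ≡ nothing →
      Step s record s
        { current = just (tgt a)
        ; traversed = upd (traversed s) a true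
        ; parent = upd (parent s) (tgt a) (just a)
        ; pre = upd (pre s) (tgt a) (just (next s))
        ; low = upd (low s) (tgt a) (just (fin (next s)))
        ; next = suc (next s) }
    -- (ii) advance on an arc to a visited vertex, and immediately retreat
    nontree : ∀ v a p x y → current s ≡ just v → src a ≡ v →
      traversed s a ≡ false → pre s (tgt a) ≡ just p →
      low s v ≡ just x → low s (tgt a) ≡ just y →
      Step s record s
        { traversed = upd (traversed s) a true
        ; retreatTime = upd (retreatTime s) a (just (clock s))
        ; clock = suc (clock s)
        ; low = upd (low s) v (just (x ⊓∞ y)) }
    postvisit-eq : ∀ v p (L : V → Maybe ℕ∞) → current s ≡ just v →
      (∀ a → src a ≡ v → traversed s a ≡ true) → postvisited s v ≡ false →
      pre s v ≡ just p → low s v ≡ just (fin p) →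
      (∀ w → Leader s v w → L w ≡ just ∞) →
      (∀ w → ¬ Leader s v w → L w ≡ low s w) →
      Step s record s
        { postvisited = upd (postvisited s) v true
        ; low = L }
    postvisit-neq : ∀ v p → current s ≡ just v →
      (∀ a → src a ≡ v → traversed s a ≡ true) → postvisited s v ≡ false →
      pre s v ≡ just p → ¬ (low s v ≡ just (fin p)) →
      Step s record s
        { postvisited = upd (postvisited s) v true }
    finish-root : ∀ v → current s ≡ just v → postvisited s v ≡ true →
      parent s v ≡ nothing →
      Step s record s { current = nothing }
    retreat : ∀ v a x y → current s ≡ just v → postvisited s v ≡ true →
      parent s v ≡ just a → low s (src a) ≡ just x → low s v ≡ just y →
      Step s record s
        { current = just (src a)
        ; retreatTime = upd (retreatTime s) a (just (clock s))
        ; clock = suc (clock s)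
        ; low = upd (low s) (src a) (just (x ⊓∞ y)) }

  Moment : State → Set
  Moment s = Star Step initial s

  -- retreats on the arcs of a walk, all having occurred, in reverse order:
  -- the retreat on an arc is later than the retreat on the next arc
  RetreatedAfter : State → ℕ → ∀ {x y} → Walk x y → Set
  RetreatedAfter s t nil        = ⊤
  RetreatedAfter s t (cons a w) = Σ ℕ λ t' → retreatTime s a ≡ just t' × t' < t

  RetreatingIn : State → (V → Set) → ∀ {x y} → Walk x y → Set
  RetreatingIn s C (nil {x})  = C x
  RetreatingIn s C (cons a w) = C (src a) ×
    (Σ ℕ λ t → retreatTime s a ≡ just t × RetreatedAfter s t w) ×
    RetreatingIn s C w

-- Both claims are proved as an invariant of every step, together with the structural facts of
-- depth-first search: the open vertices (visited, not yet postvisited) are the current vertex and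
-- its ancestors along parent arcs, each older than its descendants, and their parent arcs have not
-- been retreated on.
-- A retreat on an arc a from v to w is the latest retreat, so the only new retreating walks from v
-- are a followed by an old retreating walk from w. If w lies in the component of v, its leader is
-- open and w.low is already the minimum over w's walks, so min{v.low, w.low} is the new minimum;
-- otherwise the leader of w is open only if it is an ancestor of v, which would put w in v's
-- component, so that leader is postvisited and w.low = ∞.
-- When a leader u is postvisited, every other member of its component is visited (follow a walk
-- from u inside the component) and younger than u, hence not on the stack, hence postvisited.
-- Leaders exist because mutual reachability is decidable: a walk may be shortened below n arcs.
module Submission where

open import Defs
open import Data.Nat using (ℕ; zero; suc; _≤_; _<_; _⊓_; _+_; z≤n; s≤s; _<?_; _≤?_)
open import Data.Nat.Properties hiding (_≟_)
open import Data.Fin using (Fin; _≟_; toℕ) renaming (zero to fzero; suc to fsuc)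
open import Data.Fin.Properties using (pigeonhole; any?)
open import Data.Bool using (Bool; true; false)
open import Data.Maybe using (Maybe; just; nothing)
open import Data.Maybe.Properties using (just-injective)
open import Data.Product using (Σ; _×_; _,_; proj₁; proj₂)
open import Data.Sum using (_⊎_; inj₁; inj₂)
open import Data.Unit using (tt)
open import Function using (_∘_)
open import Relation.Nullary using (¬_; Dec; yes; no; contradiction)
open import Relation.Nullary.Decidable using (_×-dec_)
open import Relation.Binary.PropositionalEquality
open import Relation.Binary.Construct.Closure.ReflexiveTransitive using (Star; ε; _◅_)

upd-updates : ∀ {k} {B : Set} (f : Fin k → B) i x → upd f i x i ≡ x
upd-updates f i x with i ≟ i
... | yes _ = refl
... | no i≢i = contradiction refl i≢i

upd-minimal : ∀ {k} {B : Set} (f : Fin k → B) i x j → i ≢ j → upd f i x j ≡ f j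
upd-minimal f i x j i≢j with i ≟ j
... | yes i≡j = contradiction i≡j i≢j
... | no _ = refl

upd-preserves-true : ∀ {k} (f : Fin k → Bool) i j → f j ≡ true → upd f i true j ≡ true
upd-preserves-true f i j fj with i ≟ j
... | yes _ = refl
... | no _ = fj

nothing≢just : ∀ {B : Set} {x : B} → nothing ≢ just x
nothing≢just ()

true≢false : true ≢ false
true≢false ()

IsMinimum-cong : ∀ {P R : ℕ → Set} {m} → (∀ q → R q → P q) → (∀ q → P q → R q) →
                 IsMinimum P m → IsMinimum R m
IsMinimum-cong R⇒P P⇒R (Pm , least) = P⇒R _ Pm , λ q → least q ∘ R⇒P q

IsMinimum-⊎ : ∀ {P Q R : ℕ → Set} {m k} → (∀ q → R q → P q ⊎ Q q) →
              (∀ q → P q → R q) → (∀ q → Q q → R q) →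
              IsMinimum P m → IsMinimum Q k → IsMinimum R (m ⊓ k)
IsMinimum-⊎ {R = R} {m} {k} R⇒P⊎Q P⇒R Q⇒R (Pm , leastP) (Qk , leastQ) = Rm⊓k , least
  where
  Rm⊓k : R (m ⊓ k)
  Rm⊓k with ⊓-sel m k
  ... | inj₁ m⊓k≡m = subst R (sym m⊓k≡m) (P⇒R m Pm)
  ... | inj₂ m⊓k≡k = subst R (sym m⊓k≡k) (Q⇒R k Qk)
  least : ∀ q → R q → m ⊓ k ≤ q
  least q Rq with R⇒P⊎Q q Rq
  ... | inj₁ Pq = ≤-trans (m⊓n≤m m k) (leastP q Pq)
  ... | inj₂ Qq = ≤-trans (m⊓n≤n m k) (leastQ q Qq)

LeastValue : ∀ {k} → (Fin k → Maybe ℕ) → Set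
LeastValue {k} f = Σ (Fin k) λ u → Σ ℕ λ p → f u ≡ just p × (∀ t q → f t ≡ just q → p ≤ q)

leastValue : ∀ {k} (f : Fin k → Maybe ℕ) → LeastValue f ⊎ (∀ t → f t ≡ nothing)
leastValue {zero} f = inj₂ λ ()
leastValue {suc k} f with f fzero in f0 | leastValue (f ∘ fsuc)
... | nothing | inj₂ none = inj₂ λ { fzero → f0 ; (fsuc t) → none t }
... | nothing | inj₁ (u , p , fu , least) =
  inj₁ (fsuc u , p , fu , λ { fzero q f0′ → contradiction (trans (sym f0) f0′) nothing≢just
                            ; (fsuc t) → least t })
... | just p₀ | inj₂ none =
  inj₁ (fzero , p₀ , f0 , λ { fzero q f0′ → ≤-reflexive (just-injective (trans (sym f0) f0′))
                            ; (fsuc t) q ft → contradiction (trans (sym (none t)) ft) nothing≢just })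
... | just p₀ | inj₁ (u , p , fu , least) with p₀ ≤? p
...   | yes p₀≤p =
  inj₁ (fzero , p₀ , f0 , λ { fzero q f0′ → ≤-reflexive (just-injective (trans (sym f0) f0′))
                            ; (fsuc t) q ft → ≤-trans p₀≤p (least t q ft) })
...   | no p₀≰p =
  inj₁ (fsuc u , p , fu , λ { fzero q f0′ → subst (p ≤_) (just-injective (trans (sym f0) f0′)) (<⇒≤ (≰⇒> p₀≰p))
                            ; (fsuc t) → least t })

restrict : ∀ {P : Set} → Dec P → Maybe ℕ → Maybe ℕ
restrict (yes _) m = m
restrict (no _) _ = nothing

restrict-just : ∀ {P : Set} (P? : Dec P) {m q} → restrict P? m ≡ just q → P × m ≡ just q
restrict-just (yes P) m≡q = P , m≡q
restrict-just (no _) ()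

restrict-yes : ∀ {P : Set} (P? : Dec P) {m} → P → restrict P? m ≡ m
restrict-yes (yes _) _ = refl
restrict-yes (no ¬P) P = contradiction P ¬P

LeastOn : ∀ {k} → (Fin k → Set) → (Fin k → Maybe ℕ) → Set
LeastOn {k} P f = Σ (Fin k) λ u → P u × Σ ℕ λ p → f u ≡ just p × (∀ t q → P t → f t ≡ just q → p ≤ q)

leastOn : ∀ {k} {P : Fin k → Set} → (∀ t → Dec (P t)) → (f : Fin k → Maybe ℕ) →
          (Σ (Fin k) λ t → P t × Σ ℕ λ q → f t ≡ just q) → LeastOn P f
leastOn P? f (t , Pt , q , ft) with leastValue (λ t′ → restrict (P? t′) (f t′))
... | inj₂ none = contradiction (trans (sym (none t)) (trans (restrict-yes (P? t) Pt) ft)) nothing≢just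
... | inj₁ (u , p , fu , least) with restrict-just (P? u) fu
...   | Pu , fu′ = u , Pu , p , fu′ , λ t′ q′ Pt′ ft′ → least t′ q′ (trans (restrict-yes (P? t′) Pt′) ft′)

module Walks (G : Graph) where
  open Graph G
  open Exploration G

  length : ∀ {x y} → Walk x y → ℕ
  length nil = 0
  length (cons a ω) = suc (length ω)

  infixr 5 _++ʷ_
  _++ʷ_ : ∀ {x y z} → Walk x y → Walk y z → Walk x z
  nil ++ʷ ρ = ρ
  cons a ω ++ʷ ρ = cons a (ω ++ʷ ρ)

  length-++ʷ : ∀ {x y z} (ω : Walk x y) (ρ : Walk y z) → length (ω ++ʷ ρ) ≡ length ω + length ρ
  length-++ʷ nil ρ = refl
  length-++ʷ (cons a ω) ρ = cong suc (length-++ʷ ω ρ)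

  vertexAt : ∀ {x y} (ω : Walk x y) → Fin (suc (length ω)) → V
  vertexAt {x} ω fzero = x
  vertexAt (cons a ω) (fsuc i) = vertexAt ω i

  takeʷ : ∀ {x y} (ω : Walk x y) (i : Fin (suc (length ω))) → Walk x (vertexAt ω i)
  takeʷ ω fzero = nil
  takeʷ (cons a ω) (fsuc i) = cons a (takeʷ ω i)

  dropʷ : ∀ {x y} (ω : Walk x y) (i : Fin (suc (length ω))) → Walk (vertexAt ω i) y
  dropʷ ω fzero = ω
  dropʷ (cons a ω) (fsuc i) = dropʷ ω i

  length-takeʷ : ∀ {x y} (ω : Walk x y) i → length (takeʷ ω i) ≡ toℕ i
  length-takeʷ ω fzero = refl
  length-takeʷ (cons a ω) (fsuc i) = cong suc (length-takeʷ ω i)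

  length-dropʷ : ∀ {x y} (ω : Walk x y) i → toℕ i + length (dropʷ ω i) ≡ length ω
  length-dropʷ ω fzero = refl
  length-dropʷ (cons a ω) (fsuc i) = cong suc (length-dropʷ ω i)

  splice : ∀ {x u u′ y} → Walk x u → u ≡ u′ → Walk u′ y → Walk x y
  splice ω refl ρ = ω ++ʷ ρ

  length-splice : ∀ {x u u′ y} (ω : Walk x u) (e : u ≡ u′) (ρ : Walk u′ y) →
                  length (splice ω e ρ) ≡ length ω + length ρ
  length-splice ω refl ρ = length-++ʷ ω ρ

  -- By pigeonhole a walk with at least n arcs repeats a vertex; cutting out the loop shortens it.
  shortcut : ∀ {x y} (ω : Walk x y) → n ≤ length ω → Σ (Walk x y) λ ρ → length ρ < length ω
  shortcut ω n≤len with pigeonhole (s≤s n≤len) (vertexAt ω)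
  ... | i , j , i<j , repeat = splice (takeʷ ω i) repeat (dropʷ ω j) , shorter
    where
    open ≤-Reasoning
    shorter : length (splice (takeʷ ω i) repeat (dropʷ ω j)) < length ω
    shorter = begin-strict
      length (splice (takeʷ ω i) repeat (dropʷ ω j)) ≡⟨ length-splice (takeʷ ω i) repeat (dropʷ ω j) ⟩
      length (takeʷ ω i) + length (dropʷ ω j)        ≡⟨ cong (_+ length (dropʷ ω j)) (length-takeʷ ω i) ⟩
      toℕ i + length (dropʷ ω j)                     <⟨ +-monoˡ-< (length (dropʷ ω j)) i<j ⟩
      toℕ j + length (dropʷ ω j)                     ≡⟨ length-dropʷ ω j ⟩
      length ω                                       ∎

  shortWalk : ∀ k {x y} (ω : Walk x y) → length ω ≤ k → Σ (Walk x y) λ ρ → length ρ < n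
  shortWalk k ω len≤k with length ω <? n
  ... | yes len<n = ω , len<n
  ... | no len≮n with shortcut ω (≮⇒≥ len≮n)
  shortWalk zero ω len≤k | no _ | ρ , ρ<ω = contradiction (<-≤-trans ρ<ω len≤k) n≮0
  shortWalk (suc k) ω len≤k | no _ | ρ , ρ<ω = shortWalk k ρ (≤-pred (≤-trans ρ<ω len≤k))

  WalkWithin : ℕ → V → V → Set
  WalkWithin k x y = Σ (Walk x y) λ ω → length ω ≤ k

  walkWithin? : ∀ k x y → Dec (WalkWithin k x y)
  walkWithin? k x y with x ≟ y
  walkWithin? k x .x | yes refl = yes (nil , z≤n)
  walkWithin? zero x y | no x≢y = no λ { (nil , _) → x≢y refl ; (cons a ω , ()) }
  walkWithin? (suc k) x y | no x≢y with any? (λ a → (src a ≟ x) ×-dec walkWithin? k (tgt a) y)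
  ... | yes (a , refl , ω , len≤k) = yes (cons a ω , s≤s len≤k)
  ... | no ¬step = no λ { (nil , _) → x≢y refl ; (cons a ω , s≤s len≤k) → ¬step (a , refl , ω , len≤k) }

  reach? : ∀ x y → Dec (Reach x y)
  reach? x y with walkWithin? n x y
  ... | yes (ω , _) = yes ω
  ... | no ¬short = no λ ω → let ρ , ρ<n = shortWalk (length ω) ω ≤-refl in ¬short (ρ , <⇒≤ ρ<n)

  mutual? : ∀ x y → Dec (Mutual x y)
  mutual? x y = reach? x y ×-dec reach? y x

  Mutual-refl : ∀ {x} → Mutual x x
  Mutual-refl = nil , nil

  Mutual-sym : ∀ {x y} → Mutual x y → Mutual y x
  Mutual-sym (xy , yx) = yx , xy

  Mutual-trans : ∀ {x y z} → Mutual x y → Mutual y z → Mutual x z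
  Mutual-trans (xy , yx) (yz , zy) = xy ++ʷ yz , zy ++ʷ yx

module Correctness (G : Graph) where
  open Graph G
  open Exploration G
  open Walks G

  Visited : State → V → Set
  Visited s x = Σ ℕ λ p → pre s x ≡ just p

  Earlier : State → V → V → Set
  Earlier s x y = Σ ℕ λ p → Σ ℕ λ q → pre s x ≡ just p × pre s y ≡ just q × p < q

  data Ancestor (par : V → Maybe A) (x : V) : V → Set where
    here : Ancestor par x x
    step : ∀ {y a} → par y ≡ just a → Ancestor par x (src a) → Ancestor par x y

  LowCandidate : State → V → ℕ → Set
  LowCandidate s v q = Σ V λ w → Σ (Walk v w) λ ω → RetreatingIn s (Mutual v) ω × pre s w ≡ just q

  record WellFormed (s : State) : Set where
    field
      pre<next             : ∀ x p → pre s x ≡ just p → p < next s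
      pre-injective        : ∀ x y p → pre s x ≡ just p → pre s y ≡ just p → x ≡ y
      retreat<clock        : ∀ a t → retreatTime s a ≡ just t → t < clock s
      retreated⇒traversed  : ∀ a t → retreatTime s a ≡ just t → traversed s a ≡ true
      traversed⇒visited    : ∀ a → traversed s a ≡ true → Visited s (src a) × Visited s (tgt a)
      postvisited⇒exhausted : ∀ x → postvisited s x ≡ true → ∀ a → src a ≡ x → traversed s a ≡ true
      postvisited⇒visited  : ∀ x → postvisited s x ≡ true → Visited s x
      parent⇒treeArc       : ∀ y a → parent s y ≡ just a →
                               tgt a ≡ y × traversed s a ≡ true × Earlier s (src a) y
      unvisited⇒parentless : ∀ x → pre s x ≡ nothing → parent s x ≡ nothing
      idle⇒postvisited     : current s ≡ nothing → ∀ x → Visited s x → postvisited s x ≡ true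
      current-visited      : ∀ c → current s ≡ just c → Visited s c
      open⇒ancestor        : ∀ c → current s ≡ just c → ∀ x → Visited s x → postvisited s x ≡ false →
                               Ancestor (parent s) x c
      ancestor⇒open        : ∀ c → current s ≡ just c → ∀ x → Ancestor (parent s) x c → x ≢ c →
                               postvisited s x ≡ false
      stack-unretreated    : ∀ c → current s ≡ just c → ∀ x a → Ancestor (parent s) x c →
                               parent s x ≡ just a → retreatTime s a ≡ nothing
      leader-postvisited   : ∀ v u → Leader s u v → postvisited s u ≡ true → postvisited s v ≡ true

  record LowCorrect (s : State) : Set where
    field
      low-open   : ∀ v u → Leader s u v → Visited s v → postvisited s u ≡ false →
                   Σ ℕ λ p → low s v ≡ just (fin p) × IsMinimum (LowCandidate s v) p
      low-closed : ∀ v u → Leader s u v → postvisited s u ≡ true → low s v ≡ just ∞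

  record Invariant (s : State) : Set where
    field
      wellFormed : WellFormed s
      lowCorrect : LowCorrect s

  Leader-visited : ∀ {s u v} → Leader s u v → Visited s u
  Leader-visited (_ , p , pu , _) = p , pu

  Leader-mutual : ∀ {s u v w} → Leader s u v → Mutual v w → Leader s u w
  Leader-mutual (vu , p , pu , least) vw =
    Mutual-trans (Mutual-sym vw) vu , p , pu , λ w′ q ww′ → least w′ q (Mutual-trans vw ww′)

  Leader-self : ∀ {s u v} → Leader s u v → Leader s u u
  Leader-self {s} L = Leader-mutual {s} L (proj₁ L)

  Leader-samePre : ∀ {s s′} → (∀ x → pre s′ x ≡ pre s x) → ∀ {u v} → Leader s u v → Leader s′ u v
  Leader-samePre same (vu , p , pu , least) =
    vu , p , trans (same _) pu , λ w q vw pw → least w q vw (trans (sym (same w)) pw)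

  leader-unique : ∀ {s u u′ v} → WellFormed s → Leader s u v → Leader s u′ v → u ≡ u′
  leader-unique W (vu , p , pu , least) (vu′ , p′ , pu′ , least′) =
    WellFormed.pre-injective W _ _ _ pu (subst (λ q → _ ≡ just q) (≤-antisym (least′ _ _ vu pu) (least _ _ vu′ pu′)) pu′)

  leader-exists : ∀ s v → Visited s v → Σ V λ u → Leader s u v
  leader-exists s v (p , pv) with leastOn (mutual? v) (pre s) (v , Mutual-refl , p , pv)
  ... | u , vu , q , pu , least = u , vu , q , pu , least

  RetreatingIn-mono : ∀ {s} {C C′ : V → Set} → (∀ x → C x → C′ x) →
                      ∀ {x y} (ω : Walk x y) → RetreatingIn s C ω → RetreatingIn s C′ ω
  RetreatingIn-mono C⇒C′ nil Cx = C⇒C′ _ Cx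
  RetreatingIn-mono C⇒C′ (cons a ω) (Cx , r , rω) = C⇒C′ _ Cx , r , RetreatingIn-mono C⇒C′ ω rω

  RetreatingIn-start : ∀ {s} {C : V → Set} {x y} (ω : Walk x y) → RetreatingIn s C ω → C x
  RetreatingIn-start nil Cx = Cx
  RetreatingIn-start (cons a ω) (Cx , _) = Cx

  RetreatingIn-end : ∀ {s} {C : V → Set} {x y} (ω : Walk x y) → RetreatingIn s C ω → C y
  RetreatingIn-end nil Cy = Cy
  RetreatingIn-end (cons a ω) (_ , _ , rω) = RetreatingIn-end ω rω

  RetreatedAfter-weaken : ∀ {s} t t′ {x y} (ω : Walk x y) → RetreatedAfter s t ω → t ≤ t′ → RetreatedAfter s t′ ω
  RetreatedAfter-weaken t t′ nil _ _ = tt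
  RetreatedAfter-weaken t t′ (cons a ω) (t″ , ra , t″<t) t≤t′ = t″ , ra , <-≤-trans t″<t t≤t′

  RetreatedAfter-sameRetreats : ∀ {s s′} → (∀ a → retreatTime s′ a ≡ retreatTime s a) →
                                ∀ t {x y} (ω : Walk x y) → RetreatedAfter s t ω → RetreatedAfter s′ t ω
  RetreatedAfter-sameRetreats same t nil _ = tt
  RetreatedAfter-sameRetreats same t (cons a ω) (t′ , ra , t′<t) = t′ , trans (same a) ra , t′<t

  RetreatingIn-sameRetreats : ∀ {s s′} {C : V → Set} → (∀ a → retreatTime s′ a ≡ retreatTime s a) →
                              ∀ {x y} (ω : Walk x y) → RetreatingIn s C ω → RetreatingIn s′ C ω
  RetreatingIn-sameRetreats same nil Cx = Cx
  RetreatingIn-sameRetreats same (cons a ω) (Cx , (t , ra , after) , rω) =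
    Cx , (t , trans (same a) ra , RetreatedAfter-sameRetreats same t ω after) , RetreatingIn-sameRetreats same ω rω

  LowCandidate-transport : ∀ {s s′} → (∀ a → retreatTime s′ a ≡ retreatTime s a) → (∀ x → pre s′ x ≡ pre s x) →
                           ∀ {v p} → IsMinimum (LowCandidate s v) p → IsMinimum (LowCandidate s′ v) p
  LowCandidate-transport same-retreats same-pre = IsMinimum-cong
    (λ q (w , ω , rω , pw) → w , ω , RetreatingIn-sameRetreats (sym ∘ same-retreats) ω rω , trans (sym (same-pre w)) pw)
    (λ q (w , ω , rω , pw) → w , ω , RetreatingIn-sameRetreats same-retreats ω rω , trans (same-pre w) pw)

  Ancestor-parent : ∀ {par x y} → Ancestor par x y → x ≢ y → Σ A λ a → par y ≡ just a × Ancestor par x (src a)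
  Ancestor-parent here x≢x = contradiction refl x≢x
  Ancestor-parent (step pa anc) _ = _ , pa , anc

  module _ {s : State} (W : WellFormed s) where
    open WellFormed W

    RetreatingIn-visited : ∀ {C : V → Set} {x y} (ω : Walk x y) → RetreatingIn s C ω → Visited s x → Visited s y
    RetreatingIn-visited nil _ vx = vx
    RetreatingIn-visited (cons a ω) (_ , (t , ra , _) , rω) _ =
      RetreatingIn-visited ω rω (proj₂ (traversed⇒visited a (retreated⇒traversed a t ra)))

    RetreatedAfter-clock : ∀ {C : V → Set} {x y} (ω : Walk x y) → RetreatingIn s C ω → RetreatedAfter s (clock s) ω
    RetreatedAfter-clock nil _ = tt
    RetreatedAfter-clock (cons a ω) (_ , (t , ra , _) , _) = t , ra , retreat<clock a t ra

    retreat<clock-stamp : ∀ a b t → upd (retreatTime s) a (just (clock s)) b ≡ just t → t < suc (clock s)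
    retreat<clock-stamp a b t rb with a ≟ b
    ... | yes refl = ≤-reflexive (cong suc (sym (just-injective rb)))
    ... | no _ = m<n⇒m<1+n (retreat<clock b t rb)

    untraversed⇒unretreated : ∀ a → traversed s a ≡ false → retreatTime s a ≡ nothing
    untraversed⇒unretreated a ta with retreatTime s a in ra
    ... | nothing = refl
    ... | just t = contradiction (trans (sym (retreated⇒traversed a t ra)) ta) true≢false

    untraversed⇒open : ∀ {v a} → src a ≡ v → traversed s a ≡ false → postvisited s v ≡ false
    untraversed⇒open {v} {a} sa ta with postvisited s v in pv
    ... | false = refl
    ... | true = contradiction (trans (sym (postvisited⇒exhausted v pv a sa)) ta) true≢false

    Ancestor-walk : ∀ {x y} → Ancestor (parent s) x y → Reach x y
    Ancestor-walk here = nil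
    Ancestor-walk (step {y} {a} pa anc) = subst (Walk _) (proj₁ (parent⇒treeArc y a pa)) (Ancestor-walk anc ++ʷ cons a nil)

    Ancestor-earlier : ∀ {x y} → Ancestor (parent s) x y → x ≡ y ⊎ Earlier s x y
    Ancestor-earlier here = inj₁ refl
    Ancestor-earlier (step {y} {a} pa anc) with parent⇒treeArc y a pa
    ... | _ , _ , p , q , pa′ , py , p<q with Ancestor-earlier anc
    ...   | inj₁ refl = inj₂ (p , q , pa′ , py , p<q)
    ...   | inj₂ (o , p′ , px , pa″ , o<p′) =
      inj₂ (o , q , px , py , <-trans o<p′ (subst (_< q) (just-injective (trans (sym pa′) pa″)) p<q))

  module VisitFresh (s s′ : State) (W : WellFormed s) (z : V) (z-unvisited : pre s z ≡ nothing)
    (pre-step  : ∀ x → pre s′ x ≡ upd (pre s) z (just (next s)) x)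
    (low-step  : ∀ x → low s′ x ≡ upd (low s) z (just (fin (next s))) x)
    (same-retreats : ∀ a → retreatTime s′ a ≡ retreatTime s a)
    (same-postvisits : ∀ x → postvisited s′ x ≡ postvisited s x) where
    open WellFormed W

    visited≢z : ∀ {x} → Visited s x → z ≢ x
    visited≢z (p , px) refl = contradiction (trans (sym z-unvisited) px) nothing≢just

    pre-z : pre s′ z ≡ just (next s)
    pre-z = trans (pre-step z) (upd-updates (pre s) z _)

    pre-other : ∀ {x} → z ≢ x → pre s′ x ≡ pre s x
    pre-other {x} z≢x = trans (pre-step x) (upd-minimal (pre s) z _ x z≢x)

    pre-lift : ∀ {x p} → pre s x ≡ just p → pre s′ x ≡ just p
    pre-lift px = trans (pre-other (visited≢z (_ , px))) px

    Visited-lift : ∀ {x} → Visited s x → Visited s′ x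
    Visited-lift (p , px) = p , pre-lift px

    Visited-z : Visited s′ z
    Visited-z = next s , pre-z

    unvisited-back : ∀ {x} → pre s′ x ≡ nothing → pre s x ≡ nothing
    unvisited-back {x} px with z ≟ x
    ... | yes refl = contradiction (trans (sym px) pre-z) nothing≢just
    ... | no z≢x = trans (sym (pre-other z≢x)) px

    pre<next′ : ∀ x p → pre s′ x ≡ just p → p < suc (next s)
    pre<next′ x p px with z ≟ x
    ... | yes refl = ≤-reflexive (cong suc (just-injective (trans (sym px) pre-z)))
    ... | no z≢x = m<n⇒m<1+n (pre<next x p (trans (sym (pre-other z≢x)) px))

    pre-injective′ : ∀ x y p → pre s′ x ≡ just p → pre s′ y ≡ just p → x ≡ y
    pre-injective′ x y p px py with z ≟ x | z ≟ y
    ... | yes refl | yes refl = refl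
    ... | yes refl | no z≢y = contradiction (just-injective (trans (sym px) pre-z))
                               (<⇒≢ (pre<next y p (trans (sym (pre-other z≢y)) py)))
    ... | no z≢x | yes refl = contradiction (just-injective (trans (sym py) pre-z))
                               (<⇒≢ (pre<next x p (trans (sym (pre-other z≢x)) px)))
    ... | no z≢x | no z≢y = pre-injective x y p (trans (sym (pre-other z≢x)) px) (trans (sym (pre-other z≢y)) py)

    -- z has the largest pre, so it leads only a component with no older vertex.
    Leader-cases : ∀ {u t} → Leader s′ u t → (u ≡ z × (∀ w → Mutual t w → ¬ Visited s w)) ⊎ Leader s u t
    Leader-cases {u} (tu , p , pu , least) with z ≟ u
    ... | yes refl = inj₁ (refl , λ w tw (q , pw) →
            let p≡next = just-injective (trans (sym pu) pre-z)
            in <-irrefl refl (≤-<-trans (subst (_≤ q) p≡next (least w q tw (pre-lift pw))) (pre<next w q pw)))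
    ... | no z≢u = inj₂ (tu , p , trans (sym (pre-other z≢u)) pu , λ w q tw pw → least w q tw (pre-lift pw))

    leader-postvisited′ : ∀ v u → Leader s′ u v → postvisited s′ u ≡ true → postvisited s′ v ≡ true
    leader-postvisited′ v u L pu with Leader-cases L
    ... | inj₁ (refl , _) = contradiction refl (visited≢z (postvisited⇒visited z (trans (sym (same-postvisits z)) pu)))
    ... | inj₂ L₀ = trans (same-postvisits v) (leader-postvisited v u L₀ (trans (sym (same-postvisits u)) pu))

    module _ (Lc : LowCorrect s) where
      open LowCorrect Lc

      candidates-unchanged : ∀ {v p} → Visited s v → IsMinimum (LowCandidate s v) p → IsMinimum (LowCandidate s′ v) p
      candidates-unchanged vv = IsMinimum-cong
        (λ q (w , ω , rω , pw) → let rω₀ = RetreatingIn-sameRetreats (sym ∘ same-retreats) ω rω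
                                 in w , ω , rω₀ , trans (sym (pre-other (visited≢z (RetreatingIn-visited W ω rω₀ vv)))) pw)
        (λ q (w , ω , rω , pw) → w , ω , RetreatingIn-sameRetreats same-retreats ω rω , pre-lift pw)

      -- No arc out of z has been retreated on yet, so only the empty walk starts at z.
      candidates-z : ∀ q → LowCandidate s′ z q → next s ≤ q
      candidates-z q (w , nil , _ , pw) = ≤-reflexive (just-injective (trans (sym pre-z) pw))
      candidates-z q (w , cons a ω , (_ , (t , ra , _) , _) , _) =
        contradiction refl (visited≢z (proj₁ (traversed⇒visited a (retreated⇒traversed a t (trans (sym (same-retreats a)) ra)))))

      low-open′ : ∀ v u → Leader s′ u v → Visited s′ v → postvisited s′ u ≡ false →
                  Σ ℕ λ p → low s′ v ≡ just (fin p) × IsMinimum (LowCandidate s′ v) p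
      low-open′ v u L vv pu with z ≟ v
      ... | yes refl = next s , trans (low-step z) (upd-updates (low s) z _) , (z , nil , Mutual-refl , pre-z) , candidates-z
      ... | no z≢v with Leader-cases L | proj₁ vv , trans (sym (pre-other z≢v)) (proj₂ vv)
      ...   | inj₁ (_ , old-free) | vv₀ = contradiction vv₀ (old-free v Mutual-refl)
      ...   | inj₂ L₀ | vv₀ with low-open v u L₀ vv₀ (trans (sym (same-postvisits u)) pu)
      ...     | p , lv , min = p , trans (trans (low-step v) (upd-minimal (low s) z _ v z≢v)) lv , candidates-unchanged vv₀ min

      low-closed′ : ∀ v u → Leader s′ u v → postvisited s′ u ≡ true → low s′ v ≡ just ∞
      low-closed′ v u L pu with Leader-cases L
      ... | inj₁ (refl , _) = contradiction refl (visited≢z (postvisited⇒visited z (trans (sym (same-postvisits z)) pu)))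
      ... | inj₂ L₀ =
        let pu₀ = trans (sym (same-postvisits u)) pu
            vv = postvisited⇒visited v (leader-postvisited v u L₀ pu₀)
        in trans (trans (low-step v) (upd-minimal (low s) z _ v (visited≢z vv))) (low-closed v u L₀ pu₀)

      lowCorrect′ : LowCorrect s′
      lowCorrect′ = record { low-open = low-open′ ; low-closed = low-closed′ }

  module RetreatOn (s s′ : State) (W : WellFormed s) (a : A) (X Y : ℕ∞)
    (same-pre : ∀ x → pre s′ x ≡ pre s x)
    (retreat-step : ∀ b → retreatTime s′ b ≡ upd (retreatTime s) a (just (clock s)) b)
    (a-unretreated : retreatTime s a ≡ nothing)
    (low-step : ∀ x → low s′ x ≡ upd (low s) (src a) (just (X ⊓∞ Y)) x)
    (low-src : low s (src a) ≡ just X) (low-tgt : low s (tgt a) ≡ just Y)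
    (same-postvisits : ∀ x → postvisited s′ x ≡ postvisited s x)
    (src-open : postvisited s (src a) ≡ false)
    (src-visited : Visited s (src a)) (tgt-visited : Visited s (tgt a))
    (open-reaches-src : ∀ u → Leader s u (tgt a) → postvisited s u ≡ false → Reach u (src a)) where
    open WellFormed W

    retreat-a : retreatTime s′ a ≡ just (clock s)
    retreat-a = trans (retreat-step a) (upd-updates (retreatTime s) a _)

    retreat-other : ∀ {b} → a ≢ b → retreatTime s′ b ≡ retreatTime s b
    retreat-other {b} a≢b = trans (retreat-step b) (upd-minimal (retreatTime s) a _ b a≢b)

    retreated≢a : ∀ {b t} → retreatTime s b ≡ just t → a ≢ b
    retreated≢a rb refl = contradiction (trans (sym a-unretreated) rb) nothing≢just

    before-clock≢a : ∀ {b t} → retreatTime s′ b ≡ just t → t < clock s → a ≢ b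
    before-clock≢a rb t<K refl = <-irrefl (just-injective (trans (sym rb) retreat-a)) t<K

    RetreatedAfter-lift : ∀ t {x y} (ω : Walk x y) → RetreatedAfter s t ω → RetreatedAfter s′ t ω
    RetreatedAfter-lift t nil _ = tt
    RetreatedAfter-lift t (cons b ω) (t′ , rb , t′<t) = t′ , trans (retreat-other (retreated≢a rb)) rb , t′<t

    RetreatingIn-lift : ∀ {C : V → Set} {x y} (ω : Walk x y) → RetreatingIn s C ω → RetreatingIn s′ C ω
    RetreatingIn-lift nil Cx = Cx
    RetreatingIn-lift (cons b ω) (Cx , (t , rb , after) , rω) =
      Cx , (t , trans (retreat-other (retreated≢a rb)) rb , RetreatedAfter-lift t ω after) , RetreatingIn-lift ω rω

    RetreatedAfter-back : ∀ t {x y} (ω : Walk x y) → RetreatedAfter s′ t ω → t ≤ clock s → RetreatedAfter s t ω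
    RetreatedAfter-back t nil _ _ = tt
    RetreatedAfter-back t (cons b ω) (t′ , rb , t′<t) t≤K =
      t′ , trans (sym (retreat-other (before-clock≢a rb (<-≤-trans t′<t t≤K)))) rb , t′<t

    RetreatingIn-back : ∀ {C : V → Set} {x y} (ω : Walk x y) → RetreatingIn s′ C ω →
                        RetreatedAfter s′ (clock s) ω → RetreatingIn s C ω
    RetreatingIn-back nil Cx _ = Cx
    RetreatingIn-back (cons b ω) (Cx , (t , rb , after) , rω) (t′ , rb′ , t′<K) =
      let t<K = subst (_< clock s) (just-injective (trans (sym rb′) rb)) t′<K
      in Cx , (t , trans (sym (retreat-other (before-clock≢a rb t<K))) rb , RetreatedAfter-back t ω after (<⇒≤ t<K)) ,
         RetreatingIn-back ω rω (RetreatedAfter-weaken t (clock s) ω after (<⇒≤ t<K))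

    -- The retreat on a is the latest, so a retreating walk can use a only as its first arc.
    RetreatingIn-split : ∀ {C : V → Set} {x y} (ω : Walk x y) → RetreatingIn s′ C ω →
      RetreatingIn s C ω ⊎ (x ≡ src a × Σ (Walk (tgt a) y) λ ω′ → RetreatingIn s C ω′)
    RetreatingIn-split nil Cx = inj₁ Cx
    RetreatingIn-split (cons b ω) (Cx , (t , rb , after) , rω) with a ≟ b
    ... | yes refl = inj₂ (refl , ω , RetreatingIn-back ω rω
                              (subst (λ t′ → RetreatedAfter s′ t′ ω) (just-injective (trans (sym rb) retreat-a)) after))
    ... | no a≢b = inj₁ (RetreatingIn-back (cons b ω) (Cx , (t , rb , after) , rω)
                          (t , rb , retreat<clock b t (trans (sym (retreat-other a≢b)) rb)))

    RetreatingIn-extend : ∀ {C : V → Set} {y} (ω : Walk (tgt a) y) → RetreatingIn s C ω → C (src a) →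
                          RetreatingIn s′ C (cons a ω)
    RetreatingIn-extend ω rω Cx = Cx , (clock s , retreat-a , RetreatedAfter-lift (clock s) ω (RetreatedAfter-clock W ω rω)) ,
                                  RetreatingIn-lift ω rω

    Leader-back : ∀ {u t} → Leader s′ u t → Leader s u t
    Leader-back = Leader-samePre {s′} {s} (sym ∘ same-pre)

    leader-postvisited′ : ∀ v u → Leader s′ u v → postvisited s′ u ≡ true → postvisited s′ v ≡ true
    leader-postvisited′ v u L pu =
      trans (same-postvisits v) (leader-postvisited v u (Leader-back L) (trans (sym (same-postvisits u)) pu))

    module _ (Lc : LowCorrect s) where
      open LowCorrect Lc

      low-src′ : low s′ (src a) ≡ just (X ⊓∞ Y)
      low-src′ = trans (low-step (src a)) (upd-updates (low s) (src a) _)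

      low-other : ∀ {t} → src a ≢ t → low s′ t ≡ low s t
      low-other {t} sa≢t = trans (low-step t) (upd-minimal (low s) (src a) _ t sa≢t)

      tgt-outside : ¬ Mutual (src a) (tgt a) → Y ≡ ∞
      tgt-outside outside with leader-exists s (tgt a) tgt-visited
      ... | u , L with postvisited s u in pu
      ...   | true = just-injective (trans (sym low-tgt) (low-closed (tgt a) u L pu))
      ...   | false = contradiction (cons a nil , proj₁ (proj₁ L) ++ʷ open-reaches-src u L pu) outside

      candidates-unchanged : ∀ {t p} → (t ≡ src a → ¬ Mutual t (tgt a)) →
                             IsMinimum (LowCandidate s t) p → IsMinimum (LowCandidate s′ t) p
      candidates-unchanged {t} not-through-a = IsMinimum-cong old
        (λ q (w , ω , rω , pw) → w , ω , RetreatingIn-lift ω rω , trans (same-pre w) pw)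
        where
        old : ∀ q → LowCandidate s′ t q → LowCandidate s t q
        old q (w , ω , rω , pw) with RetreatingIn-split ω rω
        ... | inj₁ rω₀ = w , ω , rω₀ , trans (sym (same-pre w)) pw
        ... | inj₂ (refl , ω′ , rω′) = contradiction (RetreatingIn-start ω′ rω′) (not-through-a refl)

      candidates-merge : ∀ {m k} → Mutual (src a) (tgt a) → IsMinimum (LowCandidate s (src a)) m →
                         IsMinimum (LowCandidate s (tgt a)) k → IsMinimum (LowCandidate s′ (src a)) (m ⊓ k)
      candidates-merge va = IsMinimum-⊎ old-or-tgt
        (λ q (w , ω , rω , pw) → w , ω , RetreatingIn-lift ω rω , trans (same-pre w) pw)
        (λ q (w , ω , rω , pw) → w , cons a ω ,
           RetreatingIn-extend ω (RetreatingIn-mono (λ _ → Mutual-trans va) ω rω) Mutual-refl , trans (same-pre w) pw)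
        where
        old-or-tgt : ∀ q → LowCandidate s′ (src a) q → LowCandidate s (src a) q ⊎ LowCandidate s (tgt a) q
        old-or-tgt q (w , ω , rω , pw) with RetreatingIn-split ω rω
        ... | inj₁ rω₀ = inj₁ (w , ω , rω₀ , trans (sym (same-pre w)) pw)
        ... | inj₂ (_ , ω′ , rω′) =
          inj₂ (w , ω′ , RetreatingIn-mono (λ _ → Mutual-trans (Mutual-sym va)) ω′ rω′ , trans (sym (same-pre w)) pw)

      low-open′ : ∀ v u → Leader s′ u v → Visited s′ v → postvisited s′ u ≡ false →
                  Σ ℕ λ p → low s′ v ≡ just (fin p) × IsMinimum (LowCandidate s′ v) p
      low-open′ v u L′ (p , pv) pu with Leader-back L′ | p , trans (sym (same-pre v)) pv | trans (sym (same-postvisits u)) pu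
      ... | L | vv | pu₀ with src a ≟ v
      ...   | no sa≢v with low-open v u L vv pu₀
      ...     | q , lv , min = q , trans (low-other sa≢v) lv , candidates-unchanged (λ v≡sa → contradiction (sym v≡sa) sa≢v) min
      low-open′ v u L′ _ pu | L | vv | pu₀ | yes refl with low-open (src a) u L vv pu₀
      ... | m , lv , min-src with trans (sym low-src) lv
      ...   | refl with mutual? (src a) (tgt a)
      ...     | no outside = m , subst (λ Z → low s′ (src a) ≡ just (fin m ⊓∞ Z)) (tgt-outside outside) low-src′ ,
                             candidates-unchanged (λ _ → outside) min-src
      ...     | yes va with low-open (tgt a) u (Leader-mutual {s} L va) tgt-visited pu₀
      ...       | k , lw , min-tgt with trans (sym low-tgt) lw
      ...         | refl = m ⊓ k , low-src′ , candidates-merge va min-src min-tgt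

      low-closed′ : ∀ v u → Leader s′ u v → postvisited s′ u ≡ true → low s′ v ≡ just ∞
      low-closed′ v u L′ pu with Leader-back L′ | trans (sym (same-postvisits u)) pu
      ... | L | pu₀ with src a ≟ v
      ...   | yes refl = contradiction (trans (sym (leader-postvisited (src a) u L pu₀)) src-open) true≢false
      ...   | no sa≢v = trans (low-other sa≢v) (low-closed v u L pu₀)

      lowCorrect′ : LowCorrect s′
      lowCorrect′ = record { low-open = low-open′ ; low-closed = low-closed′ }

  module RootStep (s : State) (W : WellFormed s) (z : V)
    (idle : current s ≡ nothing) (z-unvisited : pre s z ≡ nothing) where
    open WellFormed W

    s′ : State
    s′ = record s
      { current = just z
      ; pre = upd (pre s) z (just (next s))
      ; low = upd (low s) z (just (fin (next s)))
      ; next = suc (next s) }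

    open VisitFresh s s′ W z z-unvisited (λ _ → refl) (λ _ → refl) (λ _ → refl) (λ _ → refl) public

    z-root : parent s z ≡ nothing
    z-root = unvisited⇒parentless z z-unvisited

    ancestor-z : ∀ {x} → Ancestor (parent s) x z → x ≡ z
    ancestor-z here = refl
    ancestor-z (step pz _) = contradiction (trans (sym z-root) pz) nothing≢just

    open-is-z : ∀ x → Visited s′ x → postvisited s x ≡ false → z ≡ x
    open-is-z x (p , px) x-open with z ≟ x
    ... | yes z≡x = z≡x
    ... | no _ = contradiction (trans (sym (idle⇒postvisited idle x (p , px))) x-open) true≢false

    open⇒ancestor′ : ∀ c → just z ≡ just c → ∀ x → Visited s′ x → postvisited s x ≡ false → Ancestor (parent s) x c
    open⇒ancestor′ c refl x vx x-open with open-is-z x vx x-open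
    ... | refl = here

    stack-unretreated′ : ∀ c → just z ≡ just c → ∀ x a → Ancestor (parent s) x c → parent s x ≡ just a →
                         retreatTime s a ≡ nothing
    stack-unretreated′ c refl x a anc px with ancestor-z anc
    ... | refl = contradiction (trans (sym z-root) px) nothing≢just

    wellFormed′ : WellFormed s′
    wellFormed′ = record
      { pre<next = pre<next′
      ; pre-injective = pre-injective′
      ; retreat<clock = retreat<clock
      ; retreated⇒traversed = retreated⇒traversed
      ; traversed⇒visited = λ a ta → let vs , vt = traversed⇒visited a ta in Visited-lift vs , Visited-lift vt
      ; postvisited⇒exhausted = postvisited⇒exhausted
      ; postvisited⇒visited = λ x px → Visited-lift (postvisited⇒visited x px)
      ; parent⇒treeArc = λ y a pa → let ta , tr , p , q , ps , py , p<q = parent⇒treeArc y a pa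
                                     in ta , tr , p , q , pre-lift ps , pre-lift py , p<q
      ; unvisited⇒parentless = λ x px → unvisited⇒parentless x (unvisited-back px)
      ; idle⇒postvisited = λ ()
      ; current-visited = λ { c refl → Visited-z }
      ; open⇒ancestor = open⇒ancestor′
      ; ancestor⇒open = λ { c refl x anc x≢z → contradiction (ancestor-z anc) x≢z }
      ; stack-unretreated = stack-unretreated′
      ; leader-postvisited = leader-postvisited′ }

  module TreeStep (s : State) (W : WellFormed s) (a : A) (on-src : current s ≡ just (src a))
    (a-untraversed : traversed s a ≡ false) (z-unvisited : pre s (tgt a) ≡ nothing) where
    open WellFormed W

    z : V
    z = tgt a

    s′ : State
    s′ = record s
      { current = just (tgt a)
      ; traversed = upd (traversed s) a true
      ; parent = upd (parent s) (tgt a) (just a)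
      ; pre = upd (pre s) (tgt a) (just (next s))
      ; low = upd (low s) (tgt a) (just (fin (next s)))
      ; next = suc (next s) }

    open VisitFresh s s′ W z z-unvisited (λ _ → refl) (λ _ → refl) (λ _ → refl) (λ _ → refl) public

    src-visited : Visited s (src a)
    src-visited = current-visited (src a) on-src

    parent-z : parent s′ z ≡ just a
    parent-z = upd-updates (parent s) z _

    parent-other : ∀ {y} → Visited s y → parent s′ y ≡ parent s y
    parent-other {y} vy = upd-minimal (parent s) z _ y (visited≢z vy)

    parent-visited : ∀ {y b} → parent s y ≡ just b → Visited s (src b)
    parent-visited {y} {b} pb = let _ , _ , p , _ , pb′ , _ = parent⇒treeArc y b pb in p , pb′

    Ancestor-back : ∀ {x y} → Ancestor (parent s′) x y → Visited s y → Ancestor (parent s) x y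
    Ancestor-back here _ = here
    Ancestor-back (step pb anc) vy = let pb₀ = trans (sym (parent-other vy)) pb in
      step pb₀ (Ancestor-back anc (parent-visited pb₀))

    Ancestor-lift : ∀ {x y} → Ancestor (parent s) x y → Visited s y → Ancestor (parent s′) x y
    Ancestor-lift here _ = here
    Ancestor-lift (step pb anc) vy = step (trans (parent-other vy) pb) (Ancestor-lift anc (parent-visited pb))

    Ancestor-z : ∀ {x} → Ancestor (parent s′) x z → x ≢ z → Ancestor (parent s) x (src a)
    Ancestor-z anc x≢z with Ancestor-parent anc x≢z
    ... | b , pz , anc′ with just-injective (trans (sym parent-z) pz)
    ...   | refl = Ancestor-back anc′ src-visited

    traversed⇒visited′ : ∀ b → upd (traversed s) a true b ≡ true → Visited s′ (src b) × Visited s′ (tgt b)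
    traversed⇒visited′ b tb with a ≟ b
    ... | yes refl = Visited-lift src-visited , Visited-z
    ... | no _ = let vs , vt = traversed⇒visited b tb in Visited-lift vs , Visited-lift vt

    parent⇒treeArc′ : ∀ y b → parent s′ y ≡ just b →
                      tgt b ≡ y × upd (traversed s) a true b ≡ true × Earlier s′ (src b) y
    parent⇒treeArc′ y b pb with z ≟ y
    ... | yes refl with just-injective pb
    ...   | refl = refl , upd-updates (traversed s) a true , proj₁ src-visited , next s ,
                   pre-lift (proj₂ src-visited) , refl , pre<next (src a) _ (proj₂ src-visited)
    parent⇒treeArc′ y b pb | no _ =
      let tb , tr , p , q , ps , py , p<q = parent⇒treeArc y b pb
      in tb , upd-preserves-true (traversed s) a b tr , p , q , pre-lift ps , py , p<q

    unvisited⇒parentless′ : ∀ x → pre s′ x ≡ nothing → parent s′ x ≡ nothing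
    unvisited⇒parentless′ x px with z ≟ x
    ... | yes refl = contradiction (sym px) nothing≢just
    ... | no _ = unvisited⇒parentless x px

    open⇒ancestor′ : ∀ c → just z ≡ just c → ∀ x → Visited s′ x → postvisited s x ≡ false →
                     Ancestor (parent s′) x c
    open⇒ancestor′ c refl x vx x-open with z ≟ x
    ... | yes refl = here
    ... | no _ = step parent-z (Ancestor-lift (open⇒ancestor (src a) on-src x vx x-open) src-visited)

    ancestor⇒open′ : ∀ c → just z ≡ just c → ∀ x → Ancestor (parent s′) x c → x ≢ c → postvisited s x ≡ false
    ancestor⇒open′ c refl x anc x≢z with x ≟ src a
    ... | yes refl = untraversed⇒open W refl a-untraversed
    ... | no x≢sa = ancestor⇒open (src a) on-src x (Ancestor-z anc x≢z) x≢sa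

    stack-unretreated′ : ∀ c → just z ≡ just c → ∀ x b → Ancestor (parent s′) x c → parent s′ x ≡ just b →
                         retreatTime s b ≡ nothing
    stack-unretreated′ c refl x b anc pb with z ≟ x
    ... | yes refl with just-injective pb
    ...   | refl = untraversed⇒unretreated W a a-untraversed
    stack-unretreated′ c refl x b anc pb | no z≢x =
      stack-unretreated (src a) on-src x b (Ancestor-z anc (z≢x ∘ sym)) pb

    wellFormed′ : WellFormed s′
    wellFormed′ = record
      { pre<next = pre<next′
      ; pre-injective = pre-injective′
      ; retreat<clock = retreat<clock
      ; retreated⇒traversed = λ b t rb → upd-preserves-true (traversed s) a b (retreated⇒traversed b t rb)
      ; traversed⇒visited = traversed⇒visited′
      ; postvisited⇒exhausted = λ x px b sb → upd-preserves-true (traversed s) a b (postvisited⇒exhausted x px b sb)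
      ; postvisited⇒visited = λ x px → Visited-lift (postvisited⇒visited x px)
      ; parent⇒treeArc = parent⇒treeArc′
      ; unvisited⇒parentless = unvisited⇒parentless′
      ; idle⇒postvisited = λ ()
      ; current-visited = λ { c refl → Visited-z }
      ; open⇒ancestor = open⇒ancestor′
      ; ancestor⇒open = ancestor⇒open′
      ; stack-unretreated = stack-unretreated′
      ; leader-postvisited = leader-postvisited′ }

  module NontreeStep (s : State) (W : WellFormed s) (a : A) (p : ℕ) (X Y : ℕ∞)
    (on-src : current s ≡ just (src a)) (a-untraversed : traversed s a ≡ false)
    (tgt-pre : pre s (tgt a) ≡ just p) (low-src : low s (src a) ≡ just X) (low-tgt : low s (tgt a) ≡ just Y) where
    open WellFormed W

    s′ : State
    s′ = record s
      { traversed = upd (traversed s) a true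
      ; retreatTime = upd (retreatTime s) a (just (clock s))
      ; clock = suc (clock s)
      ; low = upd (low s) (src a) (just (X ⊓∞ Y)) }

    src-visited : Visited s (src a)
    src-visited = current-visited (src a) on-src

    open-reaches-src : ∀ u → Leader s u (tgt a) → postvisited s u ≡ false → Reach u (src a)
    open-reaches-src u L u-open = Ancestor-walk W (open⇒ancestor (src a) on-src u (Leader-visited {s} L) u-open)

    open RetreatOn s s′ W a X Y (λ _ → refl) (λ _ → refl) (untraversed⇒unretreated W a a-untraversed)
      (λ _ → refl) low-src low-tgt (λ _ → refl) (untraversed⇒open W refl a-untraversed)
      src-visited (p , tgt-pre) open-reaches-src public

    retreated⇒traversed′ : ∀ b t → upd (retreatTime s) a (just (clock s)) b ≡ just t → upd (traversed s) a true b ≡ true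
    retreated⇒traversed′ b t rb with a ≟ b
    ... | yes refl = refl
    ... | no _ = retreated⇒traversed b t rb

    traversed⇒visited′ : ∀ b → upd (traversed s) a true b ≡ true → Visited s (src b) × Visited s (tgt b)
    traversed⇒visited′ b tb with a ≟ b
    ... | yes refl = src-visited , (p , tgt-pre)
    ... | no _ = traversed⇒visited b tb

    stack-unretreated′ : ∀ c → current s ≡ just c → ∀ x b → Ancestor (parent s) x c → parent s x ≡ just b →
                         upd (retreatTime s) a (just (clock s)) b ≡ nothing
    stack-unretreated′ c cur x b anc pb =
      trans (upd-minimal (retreatTime s) a _ b a≢b) (stack-unretreated c cur x b anc pb)
      where
      a≢b : a ≢ b
      a≢b refl = contradiction (trans (sym (proj₁ (proj₂ (parent⇒treeArc x a pb)))) a-untraversed) true≢false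

    wellFormed′ : WellFormed s′
    wellFormed′ = record
      { pre<next = pre<next
      ; pre-injective = pre-injective
      ; retreat<clock = retreat<clock-stamp W a
      ; retreated⇒traversed = retreated⇒traversed′
      ; traversed⇒visited = traversed⇒visited′
      ; postvisited⇒exhausted = λ x px b sb → upd-preserves-true (traversed s) a b (postvisited⇒exhausted x px b sb)
      ; postvisited⇒visited = postvisited⇒visited
      ; parent⇒treeArc = λ y b pb → let tb , tr , earlier = parent⇒treeArc y b pb
                                     in tb , upd-preserves-true (traversed s) a b tr , earlier
      ; unvisited⇒parentless = unvisited⇒parentless
      ; idle⇒postvisited = λ idle → contradiction (trans (sym idle) on-src) nothing≢just
      ; current-visited = current-visited
      ; open⇒ancestor = open⇒ancestor
      ; ancestor⇒open = ancestor⇒open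
      ; stack-unretreated = stack-unretreated′
      ; leader-postvisited = leader-postvisited′ }

  module PostvisitStep (s : State) (W : WellFormed s) (c : V) (on-c : current s ≡ just c)
    (exhausted : ∀ a → src a ≡ c → traversed s a ≡ true) (c-open : postvisited s c ≡ false)
    (L : V → Maybe ℕ∞) where
    open WellFormed W

    s′ : State
    s′ = record s { postvisited = upd (postvisited s) c true ; low = L }

    open-back : ∀ x → postvisited s′ x ≡ false → postvisited s x ≡ false
    open-back x px with c ≟ x
    ... | yes refl = contradiction px true≢false
    ... | no _ = px

    postvisited⇒exhausted′ : ∀ x → postvisited s′ x ≡ true → ∀ a → src a ≡ x → traversed s a ≡ true
    postvisited⇒exhausted′ x px a sa with c ≟ x
    ... | yes refl = exhausted a sa
    ... | no _ = postvisited⇒exhausted x px a sa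

    postvisited⇒visited′ : ∀ x → postvisited s′ x ≡ true → Visited s x
    postvisited⇒visited′ x px with c ≟ x
    ... | yes refl = current-visited c on-c
    ... | no _ = postvisited⇒visited x px

    ancestor⇒open′ : ∀ c′ → current s ≡ just c′ → ∀ x → Ancestor (parent s) x c′ → x ≢ c′ →
                     postvisited s′ x ≡ false
    ancestor⇒open′ c′ on-c′ x anc x≢c′ with c ≟ x
    ... | yes refl = contradiction (just-injective (trans (sym on-c) on-c′)) x≢c′
    ... | no _ = ancestor⇒open c′ on-c′ x anc x≢c′

    module _ (leads : Leader s c c) where

      -- An open member of c's component would lie on the stack below c, hence be older than c.
      component-postvisited : ∀ r → Mutual c r → Visited s r → c ≢ r → postvisited s r ≡ true
      component-postvisited r cr vr c≢r with postvisited s r in r-open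
      ... | true = refl
      ... | false with Ancestor-earlier W (open⇒ancestor c on-c r vr r-open)
      ...   | inj₁ r≡c = contradiction (sym r≡c) c≢r
      ...   | inj₂ (p , q , pr , pc , p<q) =
        let _ , pc′ , pc′≡ , least = leads
        in contradiction (subst (_≤ p) (just-injective (trans (sym pc′≡) pc)) (least r p cr pr)) (<⇒≱ p<q)

      component-visited : ∀ {x y} (ω : Walk x y) → Reach y c → Reach c x → Visited s x → Visited s y
      component-visited nil _ _ vx = vx
      component-visited (cons b ω) yc cx vx = component-visited ω yc (cx ++ʷ cons b nil) (proj₂ (traversed⇒visited b b-traversed))
        where
        b-traversed : traversed s b ≡ true
        b-traversed with src b ≟ c
        ... | yes sb≡c = exhausted b sb≡c
        ... | no sb≢c = postvisited⇒exhausted (src b)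
                          (component-postvisited (src b) (cx , cons b ω ++ʷ yc) vx (sb≢c ∘ sym)) b refl

    leader-postvisited′ : ∀ v u → Leader s′ u v → postvisited s′ u ≡ true → postvisited s′ v ≡ true
    leader-postvisited′ v u L′ pu with c ≟ u
    ... | no _ = upd-preserves-true (postvisited s) c v (leader-postvisited v u L′ pu)
    ... | yes refl with c ≟ v
    ...   | yes _ = refl
    ...   | no c≢v = component-postvisited (Leader-self {s} L′) v (Mutual-sym (proj₁ L′))
                       (component-visited (Leader-self {s} L′) (proj₂ (proj₁ L′)) (proj₁ (proj₁ L′)) nil
                          (current-visited c on-c)) c≢v

    wellFormed′ : WellFormed s′
    wellFormed′ = record
      { pre<next = pre<next
      ; pre-injective = pre-injective
      ; retreat<clock = retreat<clock
      ; retreated⇒traversed = retreated⇒traversed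
      ; traversed⇒visited = traversed⇒visited
      ; postvisited⇒exhausted = postvisited⇒exhausted′
      ; postvisited⇒visited = postvisited⇒visited′
      ; parent⇒treeArc = parent⇒treeArc
      ; unvisited⇒parentless = unvisited⇒parentless
      ; idle⇒postvisited = λ idle → contradiction (trans (sym idle) on-c) nothing≢just
      ; current-visited = current-visited
      ; open⇒ancestor = λ c′ on-c′ x vx px → open⇒ancestor c′ on-c′ x vx (open-back x px)
      ; ancestor⇒open = ancestor⇒open′
      ; stack-unretreated = stack-unretreated
      ; leader-postvisited = leader-postvisited′ }

  module PostvisitLeaderStep (s : State) (W : WellFormed s) (c : V) (on-c : current s ≡ just c)
    (exhausted : ∀ a → src a ≡ c → traversed s a ≡ true) (c-open : postvisited s c ≡ false)
    (L : V → Maybe ℕ∞) (L-led : ∀ w → Leader s c w → L w ≡ just ∞)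
    (L-other : ∀ w → ¬ Leader s c w → L w ≡ low s w) where

    open PostvisitStep s W c on-c exhausted c-open L public

    module _ (Lc : LowCorrect s) where
      open LowCorrect Lc

      not-led : ∀ {u t} → Leader s u t → c ≢ u → L t ≡ low s t
      not-led {t = t} Lu c≢u = L-other t λ c-leads → c≢u (leader-unique W c-leads Lu)

      lowCorrect′ : LowCorrect s′
      lowCorrect′ = record { low-open = low-open′ ; low-closed = low-closed′ }
        where
        low-open′ : ∀ v u → Leader s′ u v → Visited s′ v → postvisited s′ u ≡ false →
                    Σ ℕ λ p → L v ≡ just (fin p) × IsMinimum (LowCandidate s′ v) p
        low-open′ v u Lu vv pu with c ≟ u
        ... | yes refl = contradiction pu true≢false
        ... | no c≢u = let p , lv , min = low-open v u Lu vv pu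
                       in p , trans (not-led Lu c≢u) lv , LowCandidate-transport {s} (λ _ → refl) (λ _ → refl) min

        low-closed′ : ∀ v u → Leader s′ u v → postvisited s′ u ≡ true → L v ≡ just ∞
        low-closed′ v u Lu pu with c ≟ u
        ... | yes refl = L-led v Lu
        ... | no c≢u = trans (not-led Lu c≢u) (low-closed v u Lu pu)

  module PostvisitNonLeaderStep (s : State) (W : WellFormed s) (c : V) (p : ℕ) (on-c : current s ≡ just c)
    (exhausted : ∀ a → src a ≡ c → traversed s a ≡ true) (c-open : postvisited s c ≡ false)
    (pre-c : pre s c ≡ just p) (low≢pre : low s c ≢ just (fin p)) where

    open PostvisitStep s W c on-c exhausted c-open (low s) public

    module _ (Lc : LowCorrect s) where
      open LowCorrect Lc

      -- A leader's candidates include itself (empty walk) and nothing older, so its low is its pre.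
      leads-nothing : ∀ t → ¬ Leader s c t
      leads-nothing t Lt with Leader-self {s} Lt
      ... | Lcc@(_ , q , pc , least) with low-open c c Lcc (p , pre-c) c-open
      ...   | m , lc , (w , ω , rω , pw) , m-least =
        let m≤p = m-least p (c , nil , Mutual-refl , pre-c)
            p≤m = subst (_≤ m) (just-injective (trans (sym pc) pre-c)) (least w m (RetreatingIn-end ω rω) pw)
        in low≢pre (subst (λ k → low s c ≡ just (fin k)) (≤-antisym m≤p p≤m) lc)

      lowCorrect′ : LowCorrect s′
      lowCorrect′ = record { low-open = low-open′ ; low-closed = low-closed′ }
        where
        low-open′ : ∀ v u → Leader s′ u v → Visited s′ v → postvisited s′ u ≡ false →
                    Σ ℕ λ q → low s v ≡ just (fin q) × IsMinimum (LowCandidate s′ v) q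
        low-open′ v u Lu vv pu with c ≟ u
        ... | yes refl = contradiction pu true≢false
        ... | no _ = let q , lv , min = low-open v u Lu vv pu in q , lv , LowCandidate-transport {s} (λ _ → refl) (λ _ → refl) min

        low-closed′ : ∀ v u → Leader s′ u v → postvisited s′ u ≡ true → low s v ≡ just ∞
        low-closed′ v u Lu pu with c ≟ u
        ... | yes refl = contradiction Lu (leads-nothing v)
        ... | no _ = low-closed v u Lu pu

  module FinishRootStep (s : State) (W : WellFormed s) (c : V) (on-c : current s ≡ just c)
    (c-closed : postvisited s c ≡ true) (c-root : parent s c ≡ nothing) where
    open WellFormed W

    s′ : State
    s′ = record s { current = nothing }

    all-postvisited : ∀ x → Visited s x → postvisited s x ≡ true
    all-postvisited x vx with postvisited s x in x-open
    ... | true = refl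
    ... | false with x ≟ c
    ...   | yes refl = contradiction (trans (sym c-closed) x-open) true≢false
    ...   | no x≢c with Ancestor-parent (open⇒ancestor c on-c x vx x-open) x≢c
    ...     | _ , pc , _ = contradiction (trans (sym c-root) pc) nothing≢just

    wellFormed′ : WellFormed s′
    wellFormed′ = record
      { pre<next = pre<next
      ; pre-injective = pre-injective
      ; retreat<clock = retreat<clock
      ; retreated⇒traversed = retreated⇒traversed
      ; traversed⇒visited = traversed⇒visited
      ; postvisited⇒exhausted = postvisited⇒exhausted
      ; postvisited⇒visited = postvisited⇒visited
      ; parent⇒treeArc = parent⇒treeArc
      ; unvisited⇒parentless = unvisited⇒parentless
      ; idle⇒postvisited = λ _ → all-postvisited
      ; current-visited = λ _ ()
      ; open⇒ancestor = λ _ ()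
      ; ancestor⇒open = λ _ ()
      ; stack-unretreated = λ _ ()
      ; leader-postvisited = leader-postvisited }

    lowCorrect′ : LowCorrect s → LowCorrect s′
    lowCorrect′ Lc = record
      { low-open = λ v u L vv pu → let p , lv , min = low-open v u L vv pu
                                    in p , lv , LowCandidate-transport {s} (λ _ → refl) (λ _ → refl) min
      ; low-closed = low-closed }
      where open LowCorrect Lc

  module RetreatStep (s : State) (W : WellFormed s) (c : V) (a : A) (X Y : ℕ∞) (on-c : current s ≡ just c)
    (c-closed : postvisited s c ≡ true) (c-parent : parent s c ≡ just a)
    (low-src : low s (src a) ≡ just X) (low-c : low s c ≡ just Y) where
    open WellFormed W

    s′ : State
    s′ = record s
      { current = just (src a)
      ; retreatTime = upd (retreatTime s) a (just (clock s))
      ; clock = suc (clock s)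
      ; low = upd (low s) (src a) (just (X ⊓∞ Y)) }

    tree-arc : tgt a ≡ c × traversed s a ≡ true × Earlier s (src a) c
    tree-arc = parent⇒treeArc c a c-parent

    tgt≡c : tgt a ≡ c
    tgt≡c = proj₁ tree-arc

    src-earlier : Earlier s (src a) c
    src-earlier = proj₂ (proj₂ tree-arc)

    src-visited : Visited s (src a)
    src-visited = let p , _ , ps , _ = src-earlier in p , ps

    -- Ancestors of src a are no younger than src a, which is older than c.
    src-ancestor≢c : ∀ {x} → Ancestor (parent s) x (src a) → x ≢ c
    src-ancestor≢c anc refl with src-earlier | Ancestor-earlier W anc
    ... | p , q , ps , pc , p<q | inj₁ refl = <-irrefl (just-injective (trans (sym ps) pc)) p<q
    ... | p , q , ps , pc , p<q | inj₂ (o , p′ , px , ps′ , o<p′) =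
      <-asym (subst₂ _<_ (just-injective (trans (sym px) pc)) (just-injective (trans (sym ps′) ps)) o<p′) p<q

    src-open : postvisited s (src a) ≡ false
    src-open = ancestor⇒open c on-c (src a) (step c-parent here) (src-ancestor≢c here)

    below-c : ∀ {x} → Ancestor (parent s) x c → x ≢ c → Ancestor (parent s) x (src a)
    below-c anc x≢c with Ancestor-parent anc x≢c
    ... | b , pb , anc′ with just-injective (trans (sym c-parent) pb)
    ...   | refl = anc′

    open⇒below-c : ∀ x → Visited s x → postvisited s x ≡ false → Ancestor (parent s) x (src a)
    open⇒below-c x vx x-open = below-c (open⇒ancestor c on-c x vx x-open)
                                  λ { refl → contradiction (trans (sym c-closed) x-open) true≢false }

    open-reaches-src : ∀ u → Leader s u (tgt a) → postvisited s u ≡ false → Reach u (src a)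
    open-reaches-src u L u-open = Ancestor-walk W (open⇒below-c u (Leader-visited {s} L) u-open)

    open RetreatOn s s′ W a X Y (λ _ → refl) (λ _ → refl) (stack-unretreated c on-c c a here c-parent)
      (λ _ → refl) low-src (subst (λ w → low s w ≡ just Y) (sym tgt≡c) low-c) (λ _ → refl) src-open
      src-visited (subst (Visited s) (sym tgt≡c) (current-visited c on-c)) open-reaches-src public

    retreated⇒traversed′ : ∀ b t → upd (retreatTime s) a (just (clock s)) b ≡ just t → traversed s b ≡ true
    retreated⇒traversed′ b t rb with a ≟ b
    ... | yes refl = proj₁ (proj₂ tree-arc)
    ... | no _ = retreated⇒traversed b t rb

    stack-unretreated′ : ∀ c′ → just (src a) ≡ just c′ → ∀ x b → Ancestor (parent s) x c′ → parent s x ≡ just b →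
                         upd (retreatTime s) a (just (clock s)) b ≡ nothing
    stack-unretreated′ c′ refl x b anc pb =
      trans (upd-minimal (retreatTime s) a _ b a≢b) (stack-unretreated c on-c x b (step c-parent anc) pb)
      where
      a≢b : a ≢ b
      a≢b refl = src-ancestor≢c anc (trans (sym (proj₁ (parent⇒treeArc x a pb))) tgt≡c)

    wellFormed′ : WellFormed s′
    wellFormed′ = record
      { pre<next = pre<next
      ; pre-injective = pre-injective
      ; retreat<clock = retreat<clock-stamp W a
      ; retreated⇒traversed = retreated⇒traversed′
      ; traversed⇒visited = traversed⇒visited
      ; postvisited⇒exhausted = postvisited⇒exhausted
      ; postvisited⇒visited = postvisited⇒visited
      ; parent⇒treeArc = parent⇒treeArc
      ; unvisited⇒parentless = unvisited⇒parentless
      ; idle⇒postvisited = λ ()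
      ; current-visited = λ { c′ refl → src-visited }
      ; open⇒ancestor = λ { c′ refl → open⇒below-c }
      ; ancestor⇒open = λ { c′ refl x anc x≢sa → ancestor⇒open c on-c x (step c-parent anc) (src-ancestor≢c anc) }
      ; stack-unretreated = stack-unretreated′
      ; leader-postvisited = leader-postvisited′ }

  invariant-initial : Invariant initial
  invariant-initial = record
    { wellFormed = record
      { pre<next = λ _ _ ()
      ; pre-injective = λ _ _ _ ()
      ; retreat<clock = λ _ _ ()
      ; retreated⇒traversed = λ _ _ ()
      ; traversed⇒visited = λ _ ()
      ; postvisited⇒exhausted = λ _ ()
      ; postvisited⇒visited = λ _ ()
      ; parent⇒treeArc = λ _ _ ()
      ; unvisited⇒parentless = λ _ _ → refl
      ; idle⇒postvisited = λ _ _ ()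
      ; current-visited = λ _ ()
      ; open⇒ancestor = λ _ ()
      ; ancestor⇒open = λ _ ()
      ; stack-unretreated = λ _ ()
      ; leader-postvisited = λ { _ _ (_ , _ , () , _) } }
    ; lowCorrect = record
      { low-open = λ { _ _ (_ , _ , () , _) }
      ; low-closed = λ { _ _ (_ , _ , () , _) } } }

  invariant-step : ∀ {s s′} → Invariant s → Step s s′ → Invariant s′
  invariant-step (record { wellFormed = W ; lowCorrect = Lc }) st = go st
    where
    go : ∀ {s′} → Step _ s′ → Invariant s′
    go (root z idle z-unvisited) = record { wellFormed = wellFormed′ ; lowCorrect = lowCorrect′ Lc }
      where open RootStep _ W z idle z-unvisited
    go (tree .(src a) a on-src refl ta z-unvisited) = record { wellFormed = wellFormed′ ; lowCorrect = lowCorrect′ Lc }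
      where open TreeStep _ W a on-src ta z-unvisited
    go (nontree .(src a) a p X Y on-src refl ta pt ls lt) = record { wellFormed = wellFormed′ ; lowCorrect = lowCorrect′ Lc }
      where open NontreeStep _ W a p X Y on-src ta pt ls lt
    go (postvisit-eq c _ L on-c ex c-open _ _ L-led L-other) = record { wellFormed = wellFormed′ ; lowCorrect = lowCorrect′ Lc }
      where open PostvisitLeaderStep _ W c on-c ex c-open L L-led L-other
    go (postvisit-neq c p on-c ex c-open pc low≢pre) = record { wellFormed = wellFormed′ ; lowCorrect = lowCorrect′ Lc }
      where open PostvisitNonLeaderStep _ W c p on-c ex c-open pc low≢pre
    go (finish-root c on-c c-closed c-root) = record { wellFormed = wellFormed′ ; lowCorrect = lowCorrect′ Lc }
      where open FinishRootStep _ W c on-c c-closed c-root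
    go (retreat c a X Y on-c c-closed c-parent ls lc) = record { wellFormed = wellFormed′ ; lowCorrect = lowCorrect′ Lc }
      where open RetreatStep _ W c a X Y on-c c-closed c-parent ls lc

  invariant : ∀ {s} → Moment s → Invariant s
  invariant = go invariant-initial
    where
    go : ∀ {s s′} → Invariant s → Star Step s s′ → Invariant s′
    go I ε = I
    go I (st ◅ sts) = go (invariant-step I st) sts

lemma13 : (G : Graph) → let open Exploration G in
    ∀ s → Moment s → ∀ v u → Leader s u v →
      ((Σ ℕ λ p → pre s v ≡ just p) → postvisited s u ≡ false →
        Σ ℕ λ p → low s v ≡ just (fin p) ×
          IsMinimum (λ q → Σ V λ w → Σ (Walk v w) λ ω →
                       RetreatingIn s (Mutual v) ω × pre s w ≡ just q) p)
      × (postvisited s u ≡ true → low s v ≡ just ∞)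
lemma13 G s moment v u L = low-open v u L , low-closed v u L
  where
  open Correctness G
  open LowCorrect (Invariant.lowCorrect (invariant moment))
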